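{- Let $\mathcal{A}$ be an $\mathbf{HpsUL}^\ast_\omega$-chain, let $B\subseteq A$ with $\{e,f,\bot,\top\}\subseteq B$, and let $M$, $D$, $\cdot^D$ be as described in the context. Then for all $X,Y\in D$: $X\cdot^DY\subseteq(e]$ iff $X\cdot^DY\cdot^DY\subseteq(e]$.
   Context: An $\mathbf{HpsUL}$-algebra is an algebra $\langle A,\wedge,\vee,\cdot,\backslash,/,e,f,\bot,\top\rangle$ with $\langle A,\wedge,\vee,\bot,\top\rangle$ a bounded lattice, $\langle A,\cdot,e\rangle$ a monoid, $xy\le z$ iff $x\le z/y$ iff $y\le x\backslash z$, and $\lambda_u((x\vee y)\backslash x)\vee\rho_v((x\vee y)\backslash y)=e$ for all $x,y,u,v$ ($\lambda_a(b)=(a\backslash(ba))\wedge e$, $\rho_a(b)=((ab)/a)\wedge e$). An $\mathbf{HpsUL}^\ast_\omega$-algebra is an $\mathbf{HpsUL}$-algebra with ($xy\le e\Rightarrow yx\le e$) and $x\backslash e=x^2\backslash e$; a chain is a linearly ordered one. Construction: $M$ is the submonoid of $\langle A,\cdot,e\rangle$ generated by $B$. For $a_1,a_2\in M$ and $b\in B$ put $[a_1,a_2;b]=\{c\in M: a_1ca_2\le b\}$; $\bar D$ is the set of all such sets, and $D=\{\bigcap\chi:\chi\subseteq\bar D\}$ (with $\bigcap\emptyset=M$). For $X\subseteq M$, $C(X)$ is the intersection of all members of $\bar D$ containing $X$. For $X,Y\subseteq M$: $XY=\{xy:x\in X,y\in Y\}$ and $X\cdot^DY=C(XY)$. For $b\in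 A$, $(b]=\{c\in M:c\le b\}$. -}

module Defs where

open import Level using (0ℓ)
open import Data.Product using (Σ; ∃; _×_; _,_)
open import Data.Sum using (_⊎_)
open import Function.Bundles using (_⇔_)
open import Relation.Binary.PropositionalEquality using (_≡_)
open import Algebra.Core using (Op₂)
import Algebra.Structures as AS
import Algebra.Lattice.Structures as LS

record HpsUL : Set₁ where
  infixr 7 _\\_
  infixl 7 _//_
  infixl 8 _·_
  infixr 6 _∧_
  infixr 5 _∨_
  infix 4 _≤_
  field
    Carrier : Set
    _∧_ _∨_ _·_ _\\_ _//_ : Op₂ Carrier
    e f ⊥ ⊤ : Carrier
    isLattice : LS.IsLattice (_≡_ {A = Carrier}) _∨_ _∧_
    isMonoid  : AS.IsMonoid (_≡_ {A = Carrier}) _·_ e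

  _≤_ : Carrier → Carrier → Set
  x ≤ y = x ∧ y ≡ x

  field
    ⊥-least    : ∀ x → ⊥ ≤ x
    ⊤-greatest : ∀ x → x ≤ ⊤
    resid-right : ∀ x y z → (x · y ≤ z) ⇔ (x ≤ z // y)
    resid-left  : ∀ x y z → (x · y ≤ z) ⇔ (y ≤ x \\ z)

  λ[_] : Carrier → Carrier → Carrier
  λ[ a ] b = (a \\ (b · a)) ∧ e
  ρ[_] : Carrier → Carrier → Carrier
  ρ[ a ] b = ((a · b) // a) ∧ e

  field
    prelinearity : ∀ x y u v →
      (λ[ u ] ((x ∨ y) \\ x)) ∨ (ρ[ v ] ((x ∨ y) \\ y)) ≡ e

record HpsUL*ω : Set₁ where
  field
    hpsUL : HpsUL
  open HpsUL hpsUL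
  field
    e-cyclic : ∀ x y → x · y ≤ e → y · x ≤ e
    ω-law    : ∀ x → x \\ e ≡ (x · x) \\ e

record HpsUL*ωChain : Set₁ where
  field
    alg : HpsUL*ω
  open HpsUL*ω alg public
  open HpsUL hpsUL public
  field
    linear : ∀ x y → (x ≤ y) ⊎ (y ≤ x)

module Construction (𝒜 : HpsUL*ωChain) (B : HpsUL*ωChain.Carrier 𝒜 → Set) where
  open HpsUL*ωChain 𝒜

  Subset : Set₁
  Subset = Carrier → Set

  _⊆_ : Subset → Subset → Set
  X ⊆ Y = ∀ c → X c → Y c

  data M : Carrier → Set where
    gen  : ∀ {b} → B b → M b
    unit : M e
    mul  : ∀ {x y} → M x → M y → M (x · y)

  -- indices (a₁, a₂, b) with a₁, a₂ ∈ M, b ∈ B of the members of D̄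
  record Idx : Set where
    constructor idx
    field
      a₁ a₂ b : Carrier
      a₁∈M : M a₁
      a₂∈M : M a₂
      b∈B  : B b

  ⟦_⟧ : Idx → Subset
  ⟦ idx a₁ a₂ b _ _ _ ⟧ c = M c × (a₁ · c · a₂ ≤ b)

  ⋂ : (Idx → Set) → Subset
  ⋂ χ c = M c × (∀ i → χ i → ⟦ i ⟧ c)

  InD : Subset → Set₁
  InD X = Σ (Idx → Set) λ χ → ∀ c → X c ⇔ ⋂ χ c

  C : Subset → Subset
  C X c = M c × (∀ i → X ⊆ ⟦ i ⟧ → ⟦ i ⟧ c)

  _⊙_ : Subset → Subset → Subset
  (X ⊙ Y) z = ∃ λ x → ∃ λ y → X x × Y y × z ≡ x · y

  infixl 7 _·ᴰ_
  _·ᴰ_ : Subset → Subset → Subset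
  X ·ᴰ Y = C (X ⊙ Y)

  ↓ : Carrier → Subset
  ↓ b c = M c × (c ≤ b)

-- The ω-law x \ e = x² \ e together with e-cyclicity gives x·y ≤ e ⇔ x·y·y ≤ e in A.
-- Since (e] = [e,e;e] ∈ D̄, the closure C does not change whether a set of M lies below e,
-- so X ·ᴰ Y ⊆ (e] reduces to XY ⊆ (e] and X ·ᴰ Y ·ᴰ Y ⊆ (e] to C(XY)Y ⊆ (e]. Going back,
-- XY ⊆ C(XY) and y² may be dropped. Going forth, every c ∈ C(XY) lies in [e,y;e] for y ∈ Y,
-- because x·y'·y ≤ e for x ∈ X, y' ∈ Y: in a chain y' ≤ y or y ≤ y', and x·y·y ≤ e resp.
-- x·y'·y' ≤ e bounds it.
module Submission where

open import Defs
open import Level using (0ℓ)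
open import Data.Product using (_×_; _,_; proj₁; proj₂)
open import Data.Sum using (inj₁; inj₂)
open import Function.Bundles using (_⇔_; mk⇔; Equivalence)
open import Function.Properties.Equivalence using (⇔-setoid)
open import Relation.Binary.PropositionalEquality using (refl; sym; subst)
open import Algebra.Lattice.Bundles using (Lattice)
import Algebra.Lattice.Properties.Lattice as LatticeProperties
import Algebra.Structures as AS
open import Relation.Binary.Bundles using (Poset)
import Relation.Binary.Reasoning.Setoid as SetoidReasoning

open Equivalence using (to; from)

module HpsULProperties (𝒜 : HpsUL) where
  open HpsUL 𝒜

  lattice : Lattice 0ℓ 0ℓ
  lattice = record { isLattice = isLattice }

  open LatticeProperties lattice using (∧-idem; poset)

  ≤-refl : ∀ x → x ≤ x
  ≤-refl = ∧-idem

  ≤-trans : ∀ {x y z} → x ≤ y → y ≤ z → x ≤ z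
  ≤-trans p q = sym (Poset.trans poset (sym p) (sym q))

  ·-monoʳ-≤ : ∀ c {a b} → a ≤ b → c · a ≤ c · b
  ·-monoʳ-≤ c {a} {b} a≤b =
    from (resid-left c a (c · b)) (≤-trans a≤b (to (resid-left c b (c · b)) (≤-refl _)))

  ·-monoˡ-≤ : ∀ c {a b} → a ≤ b → a · c ≤ b · c
  ·-monoˡ-≤ c {a} {b} a≤b =
    from (resid-right a c (b · c)) (≤-trans a≤b (to (resid-right b c (b · c)) (≤-refl _)))

module HpsUL*ωProperties (𝒜 : HpsUL*ω) where
  open HpsUL*ω 𝒜
  open HpsUL hpsUL
  open AS.IsMonoid isMonoid using (assoc)

  y·y·x≤e⇔y·x≤e : ∀ y x → (y · y) · x ≤ e ⇔ y · x ≤ e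
  y·y·x≤e⇔y·x≤e y x = mk⇔
    (λ p → from (resid-left y x e) (subst (x ≤_) (sym (ω-law y)) (to (resid-left (y · y) x e) p)))
    (λ p → from (resid-left (y · y) x e) (subst (x ≤_) (ω-law y) (to (resid-left y x e) p)))

  x·y≤e⇔x·y·y≤e : ∀ x y → x · y ≤ e ⇔ x · y · y ≤ e
  x·y≤e⇔x·y·y≤e x y = mk⇔
    (λ p → subst (_≤ e) (sym (assoc x y y))
      (e-cyclic (y · y) x (from (y·y·x≤e⇔y·x≤e y x) (e-cyclic x y p))))
    (λ p → e-cyclic y x (to (y·y·x≤e⇔y·x≤e y x)
      (e-cyclic x (y · y) (subst (_≤ e) (assoc x y y) p))))

module HpsUL*ωChainProperties (𝒜 : HpsUL*ωChain) where
  open HpsUL*ωChain 𝒜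
  open HpsULProperties hpsUL
  open HpsUL*ωProperties alg

  x·y≤e∧x·y′≤e⇒x·y·y′≤e : ∀ {x y y′} → x · y ≤ e → x · y′ ≤ e → x · y · y′ ≤ e
  x·y≤e∧x·y′≤e⇒x·y·y′≤e {x} {y} {y′} xy≤e xy′≤e with linear y y′
  ... | inj₁ y≤y′ = ≤-trans (·-monoˡ-≤ y′ (·-monoʳ-≤ x y≤y′)) (to (x·y≤e⇔x·y·y≤e x y′) xy′≤e)
  ... | inj₂ y′≤y = ≤-trans (·-monoʳ-≤ (x · y) y′≤y) (to (x·y≤e⇔x·y·y≤e x y) xy≤e)

module ConstructionProperties (𝒜 : HpsUL*ωChain) (B : HpsUL*ωChain.Carrier 𝒜 → Set) where
  open HpsUL*ωChain 𝒜
  open Construction 𝒜 B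
  open AS.IsMonoid isMonoid using (identityˡ; identityʳ)
  open HpsUL*ωProperties alg using (x·y≤e⇔x·y·y≤e)
  open HpsUL*ωChainProperties 𝒜 using (x·y≤e∧x·y′≤e⇒x·y·y′≤e)

  InD⇒⊆M : ∀ {X} → InD X → X ⊆ M
  InD⇒⊆M (_ , X⇔⋂χ) c c∈X = proj₁ (to (X⇔⋂χ c) c∈X)

  ⊙-⊆M : ∀ {X Y} → X ⊆ M → Y ⊆ M → (X ⊙ Y) ⊆ M
  ⊙-⊆M X⊆M Y⊆M _ (x , y , x∈X , y∈Y , refl) = mul (X⊆M x x∈X) (Y⊆M y y∈Y)

  C-⊆M : ∀ {W} → C W ⊆ M
  C-⊆M _ = proj₁

  ⊆C : ∀ {W} → W ⊆ M → W ⊆ C W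
  ⊆C W⊆M w w∈W = W⊆M w w∈W , λ i W⊆i → W⊆i w w∈W

  C-least : ∀ {W} i → W ⊆ ⟦ i ⟧ → C W ⊆ ⟦ i ⟧
  C-least i W⊆i c (_ , c∈C) = c∈C i W⊆i

  idx-·≤ : ∀ {a b} → M a → B b → Idx
  idx-·≤ a∈M b∈B = idx _ _ _ unit a∈M b∈B

  ⟦idx-·≤⟧⇔ : ∀ {a b} (a∈M : M a) (b∈B : B b) c → ⟦ idx-·≤ a∈M b∈B ⟧ c ⇔ (M c × c · a ≤ b)
  ⟦idx-·≤⟧⇔ {a} {b} _ _ c = mk⇔
    (λ (c∈M , p) → c∈M , subst (λ z → z · a ≤ b) (identityˡ c) p)
    (λ (c∈M , p) → c∈M , subst (λ z → z · a ≤ b) (sym (identityˡ c)) p)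

  ↓⇔⟦idx-·≤⟧ : ∀ {b} (b∈B : B b) c → ↓ b c ⇔ ⟦ idx-·≤ unit b∈B ⟧ c
  ↓⇔⟦idx-·≤⟧ {b} b∈B c = mk⇔
    (λ (c∈M , p) → from (⟦idx-·≤⟧⇔ unit b∈B c) (c∈M , subst (_≤ b) (sym (identityʳ c)) p))
    (λ c∈i → let c∈M , p = to (⟦idx-·≤⟧⇔ unit b∈B c) c∈i in c∈M , subst (_≤ b) (identityʳ c) p)

  C⊆↓⇔⊆↓ : ∀ {W b} → B b → W ⊆ M → C W ⊆ ↓ b ⇔ W ⊆ ↓ b
  C⊆↓⇔⊆↓ {W} {b} b∈B W⊆M = mk⇔
    (λ CW⊆↓ w w∈W → CW⊆↓ w (⊆C W⊆M w w∈W))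
    (λ W⊆↓ c c∈C → from (↓⇔⟦idx-·≤⟧ b∈B c)
      (C-least (idx-·≤ unit b∈B) (λ w w∈W → to (↓⇔⟦idx-·≤⟧ b∈B w) (W⊆↓ w w∈W)) c c∈C))

  ⊙⊆↓⇔ : ∀ {X Y b} → X ⊆ M → Y ⊆ M →
         (X ⊙ Y) ⊆ ↓ b ⇔ (∀ {x y} → X x → Y y → x · y ≤ b)
  ⊙⊆↓⇔ {X} {Y} {b} X⊆M Y⊆M = mk⇔ pointwise setwise
    where
    pointwise : (X ⊙ Y) ⊆ ↓ b → ∀ {x y} → X x → Y y → x · y ≤ b
    pointwise XY⊆↓ {x} {y} x∈X y∈Y = proj₂ (XY⊆↓ (x · y) (x , y , x∈X , y∈Y , refl))
    setwise : (∀ {x y} → X x → Y y → x · y ≤ b) → (X ⊙ Y) ⊆ ↓ b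
    setwise bound z z∈XY@(_ , _ , x∈X , y∈Y , refl) = ⊙-⊆M X⊆M Y⊆M z z∈XY , bound x∈X y∈Y

  ⊙⊆↓e⇔C⊙⊆↓e : ∀ {X Y} → B e → X ⊆ M → Y ⊆ M → (X ⊙ Y) ⊆ ↓ e ⇔ (C (X ⊙ Y) ⊙ Y) ⊆ ↓ e
  ⊙⊆↓e⇔C⊙⊆↓e {X} {Y} e∈B X⊆M Y⊆M = mk⇔
    (λ XY⊆↓e → from (⊙⊆↓⇔ C-⊆M Y⊆M) (C·Y≤e (to (⊙⊆↓⇔ X⊆M Y⊆M) XY⊆↓e)))
    (λ CXY·Y⊆↓e → from (⊙⊆↓⇔ X⊆M Y⊆M) (X·Y≤e (to (⊙⊆↓⇔ C-⊆M Y⊆M) CXY·Y⊆↓e)))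
    where
    XY⊆M : (X ⊙ Y) ⊆ M
    XY⊆M = ⊙-⊆M X⊆M Y⊆M

    C·Y≤e : (∀ {x y} → X x → Y y → x · y ≤ e) → ∀ {c y} → C (X ⊙ Y) c → Y y → c · y ≤ e
    C·Y≤e X·Y≤e {c} {y} c∈C y∈Y =
      proj₂ (to (⟦idx-·≤⟧⇔ y∈M e∈B c) (C-least i XY⊆i c c∈C))
      where
      y∈M : M y
      y∈M = Y⊆M y y∈Y
      i : Idx
      i = idx-·≤ y∈M e∈B
      XY⊆i : (X ⊙ Y) ⊆ ⟦ i ⟧
      XY⊆i w w∈XY@(_ , _ , x∈X , y′∈Y , refl) = from (⟦idx-·≤⟧⇔ y∈M e∈B w)
        (XY⊆M w w∈XY , x·y≤e∧x·y′≤e⇒x·y·y′≤e (X·Y≤e x∈X y′∈Y) (X·Y≤e x∈X y∈Y))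

    X·Y≤e : (∀ {c y} → C (X ⊙ Y) c → Y y → c · y ≤ e) → ∀ {x y} → X x → Y y → x · y ≤ e
    X·Y≤e C·Y≤e {x} {y} x∈X y∈Y = from (x·y≤e⇔x·y·y≤e x y)
      (C·Y≤e (⊆C XY⊆M (x · y) (x , y , x∈X , y∈Y , refl)) y∈Y)

lemma3p7 : (𝒜 : HpsUL*ωChain) → (B : HpsUL*ωChain.Carrier 𝒜 → Set) →
    let open HpsUL*ωChain 𝒜 in
    let open Construction 𝒜 B in
    B e × B f × B ⊥ × B ⊤ →
    ∀ X Y → InD X → InD Y →
    ((X ·ᴰ Y) ⊆ ↓ e) ⇔ ((X ·ᴰ Y ·ᴰ Y) ⊆ ↓ e)
lemma3p7 𝒜 B (e∈B , _) X Y X∈D Y∈D = begin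
  (X ·ᴰ Y) ⊆ ↓ e        ≈⟨ C⊆↓⇔⊆↓ e∈B (⊙-⊆M X⊆M Y⊆M) ⟩
  (X ⊙ Y) ⊆ ↓ e         ≈⟨ ⊙⊆↓e⇔C⊙⊆↓e e∈B X⊆M Y⊆M ⟩
  ((X ·ᴰ Y) ⊙ Y) ⊆ ↓ e  ≈⟨ C⊆↓⇔⊆↓ e∈B (⊙-⊆M C-⊆M Y⊆M) ⟨
  (X ·ᴰ Y ·ᴰ Y) ⊆ ↓ e   ∎
  where
  open HpsUL*ωChain 𝒜
  open Construction 𝒜 B
  open ConstructionProperties 𝒜 B
  open SetoidReasoning (⇔-setoid 0ℓ)
  X⊆M : X ⊆ M
  X⊆M = InD⇒⊆M X∈D
  Y⊆M : Y ⊆ M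
  Y⊆M = InD⇒⊆M Y∈D
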